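{- Let $x_1,\ldots,x_n,y_1,\ldots,y_n$ be indeterminates. Then, as rational functions, \[ \sum_{\sigma\in S_n}\prod_{k=1}^{n}\frac{y_{\sigma(k)}-x_{\sigma(1)}x_{\sigma(2)}\cdots x_{\sigma(k)}}{1-x_{\sigma(1)}x_{\sigma(2)}\cdots x_{\sigma(k)}} =\sum_{\sigma\in S_n}\prod_{k=1}^{n}\frac{y_{\sigma(k)}-x_{\sigma(k)}^{\,n-k+1}}{1-x_{\sigma(1)}x_{\sigma(2)}\cdots x_{\sigma(k)}}. \]
   Context: $S_n$ is the symmetric group on $\{1,\ldots,n\}$. -}

module Defs where

open import Data.Nat using (ℕ; zero; suc; _∸_)
open import Data.Fin using (Fin; toℕ)
open import Data.Fin.Properties using () renaming (_≟_ to _≟F_)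
open import Data.List using (List; []; _∷_; [_]; map; concatMap; filter; foldr; take)
open import Data.List.Membership.Propositional using (_∈_)
open import Data.Vec using (Vec; lookup; toList) renaming ([] to []ᵥ; _∷_ to _∷ᵥ_)
open import Data.Rational using (ℚ; 0ℚ; 1ℚ; _+_; _*_; _-_; _÷_; ≢-nonZero)
open import Data.Rational.Properties using () renaming (_≟_ to _≟ℚ_)
open import Relation.Nullary using (yes; no)
open import Relation.Binary.PropositionalEquality using (_≢_)
import Data.List.Relation.Unary.Unique.DecPropositional as UniqueDec

sumℚ : List ℚ → ℚ
sumℚ = foldr _+_ 0ℚ

prodℚ : List ℚ → ℚ
prodℚ = foldr _*_ 1ℚ

_^ℚ_ : ℚ → ℕ → ℚ
q ^ℚ zero  = 1ℚ
q ^ℚ suc m = q * (q ^ℚ m)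

-- Total division; only ever used with a nonzero denominator
-- (the theorem assumes all denominators are nonzero).
_/ℚ_ : ℚ → ℚ → ℚ
p /ℚ q with q ≟ℚ 0ℚ
... | yes _   = 0ℚ
... | no q≢0  = _÷_ p q {{≢-nonZero q≢0}}

allVecs : (n m : ℕ) → List (Vec (Fin n) m)
allVecs n zero    = [ []ᵥ ]
allVecs n (suc m) = concatMap (λ i → map (i ∷ᵥ_) (allVecs n m)) (Data.List.allFin n)

-- A permutation σ ∈ S_n is represented by its list of values
-- (σ(1), …, σ(n)) as a vector; permutations are exactly the vectors
-- with pairwise distinct entries (injective maps of Fin n to itself).
Perms : (n : ℕ) → List (Vec (Fin n) n)
Perms n = filter (λ σ → UniqueDec.unique? _≟F_ (toList σ)) (allVecs n n)

sumSn : (n : ℕ) → (Vec (Fin n) n → ℚ) → ℚ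
sumSn n f = sumℚ (map f (Perms n))

-- Product over k = 1..n (here k : Fin n is 0-based, so the paper's k is toℕ k + 1).
prodK : (n : ℕ) → (Fin n → ℚ) → ℚ
prodK n f = prodℚ (map f (Data.List.allFin n))

-- x_{σ(1)} x_{σ(2)} ⋯ x_{σ(k)}, with paper-index k = toℕ k + 1.
prefixProd : {n : ℕ} → (Fin n → ℚ) → Vec (Fin n) n → Fin n → ℚ
prefixProd x σ k = prodℚ (map x (take (suc (toℕ k)) (toList σ)))

LHS : (n : ℕ) → (Fin n → ℚ) → (Fin n → ℚ) → ℚ
LHS n x y = sumSn n (λ σ → prodK n (λ k →
  (y (lookup σ k) - prefixProd x σ k) /ℚ (1ℚ - prefixProd x σ k)))

-- Right-hand side; exponent n - k + 1 (paper k) = n ∸ toℕ k (0-based k).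
RHS : (n : ℕ) → (Fin n → ℚ) → (Fin n → ℚ) → ℚ
RHS n x y = sumSn n (λ σ → prodK n (λ k →
  (y (lookup σ k) - (x (lookup σ k) ^ℚ (n ∸ toℕ k))) /ℚ (1ℚ - prefixProd x σ k)))

DenomsNonzero : (n : ℕ) → (Fin n → ℚ) → Set
DenomsNonzero n x = ∀ σ → σ ∈ Perms n → ∀ k → 1ℚ - prefixProd x σ k ≢ 0ℚ

{-# OPTIONS --safe #-}

{-
For S ⊆ {1, …, n} write x_S for ∏_{i ∈ S} x_i and consider sums, over the orderings of S, of products
of weights depending on the position, the prefix product and the current element. Splitting off the
last element of an ordering, whose prefix product is always x_S, gives recurrences in S: the left-hand
side L and the right-hand side R_t with all exponents raised by t satisfy

  (1 - x_S) L(S)   = ∑_{j ∈ S} (y_j - x_S) L(S ∖ j),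
  (1 - x_S) R_t(S) = ∑_{j ∈ S} (y_j - x_j^{t+1}) R_{t+1}(S ∖ j).

Every 1 - x_S with S ≠ ∅ is a denominator of the theorem (S is the set of the first ∣S∣ entries of
some permutation), so each recurrence, with value 1 at S = ∅, has exactly one solution. Both are
solved by the convolution C_t(S) = ∑_{U ⊆ S} x_U^t A(U) B(S ∖ U) of the ordering sums A and B with
factors -P/(1-P) and y/(1-P): splitting 1 - x_S = (1 - x_U) + x_U (1 - x_{S∖U}), respectively
1 - x_S = x_{S∖U} (1 - x_U) + (1 - x_{S∖U}), the recurrences of A and B combine into that of R_t,
respectively of L. Hence L = C_0 = R_0.
-}

module Submission where

open import Defs
open import Algebra.Bundles using (CommutativeMonoid; CommutativeRing)
open import Data.Bool using (Bool; true; false; if_then_else_; _∧_; _∨_; not)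
open import Data.Bool.Properties using (∧-comm; ∧-assoc; ∧-zeroʳ; ∧-identityʳ; ∧-commutativeMonoid)
open import Data.Empty using (⊥-elim)
open import Data.Fin using (Fin; zero; suc; toℕ; fromℕ<)
open import Data.Fin.Properties using (toℕ-fromℕ<) renaming (_≟_ to _≟F_)
open import Data.Fin.Subset using (Subset; ⊤; ∣_∣; _─_)
open import Data.Fin.Subset.Properties using (∣⊤∣≡n; ∣p∣≤n)
open import Data.Nat using (ℕ; zero; suc; _∸_; _<_; _≤_) renaming (_+_ to _+ℕ_)
import Data.Nat.Properties as ℕ
open import Data.List using (List; []; _∷_; map; _++_; concatMap; filter; take; allFin)
open import Data.List.Properties using (map-++; map-tabulate; map-cong; map-∘)
open import Data.List.Relation.Unary.All using (All; []; _∷_)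
open import Data.List.Relation.Unary.Any using (here)
open import Data.List.Membership.Propositional using (_∈_)
open import Data.List.Membership.Propositional.Properties using (∈-filter⁺; ∈-concat⁺′; ∈-map⁺; ∈-allFin)
import Data.List.Relation.Unary.All as All
open import Data.List.Relation.Unary.AllPairs using ([]; _∷_)
open import Data.List.Relation.Unary.Unique.Propositional using (Unique)
open import Data.List.Relation.Unary.Unique.DecPropositional using (unique?)
open import Data.Product using (Σ; _,_; _×_; proj₁)
open import Data.Rational using (ℚ; 0ℚ; 1ℚ; _+_; _*_; _-_; -_; 1/_; ≢-nonZero)
open import Data.Rational.Properties
  using (_≟_; +-*-commutativeRing; *-inverseˡ; *-inverseʳ; *-assoc; *-distribˡ-+; +-assoc
        ; +-identityˡ; +-identityʳ; *-identityˡ; *-identityʳ; *-zeroʳ)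
open import Data.Rational.Solver using (module +-*-Solver)
open import Data.Vec using (Vec; lookup; toList) renaming ([] to []ᵥ; _∷_ to _∷ᵥ_)
open import Data.Vec.Properties using (lookup-replicate)
open import Relation.Nullary using (yes; no; does)
open import Relation.Unary using (Decidable)
open import Function using (_∘_)
open import Relation.Binary.PropositionalEquality

open import Algebra.Properties.Semiring.Sum (CommutativeRing.semiring +-*-commutativeRing)
  using (sum; sum-cong-≗; ∑-distrib-+; ∑-comm; *-distribˡ-sum; sum-replicate-zero)
open import Algebra.Properties.CommutativeSemigroup (CommutativeMonoid.commutativeSemigroup ∧-commutativeMonoid)
  using () renaming (x∙yz≈y∙xz to ∧-left-comm)

variable
  m n : ℕ

open +-*-Solver
open ≡-Reasoning

q*[p/q]≡p : ∀ p q → q ≢ 0ℚ → q * (p /ℚ q) ≡ p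
q*[p/q]≡p p q q≢0 with q ≟ 0ℚ
... | yes q≡0 = ⊥-elim (q≢0 q≡0)
... | no q≢0′ = begin
  q * (p * 1/q)   ≡⟨ solve 3 (λ q p r → q :* (p :* r) := p :* (q :* r)) refl q p 1/q ⟩
  p * (q * 1/q)   ≡⟨ cong (p *_) (*-inverseʳ q) ⟩
  p * 1ℚ          ≡⟨ *-identityʳ p ⟩
  p               ∎
  where
  instance _ = ≢-nonZero q≢0′
  1/q = 1/ q

*-cancelˡ-≢0 : ∀ a {p q} → a ≢ 0ℚ → a * p ≡ a * q → p ≡ q
*-cancelˡ-≢0 a {p} {q} a≢0 ap≡aq = begin
  p               ≡⟨ sym (cancel p) ⟩
  1/ a * (a * p)  ≡⟨ cong (1/ a *_) ap≡aq ⟩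
  1/ a * (a * q)  ≡⟨ cancel q ⟩
  q               ∎
  where
  instance _ = ≢-nonZero a≢0
  cancel : ∀ r → 1/ a * (a * r) ≡ r
  cancel r = trans (sym (*-assoc (1/ a) a r)) (trans (cong (_* r) (*-inverseˡ a)) (*-identityˡ r))

^ℚ-distribʳ-* : ∀ a b k → (a * b) ^ℚ k ≡ a ^ℚ k * b ^ℚ k
^ℚ-distribʳ-* a b zero    = refl
^ℚ-distribʳ-* a b (suc k) = begin
  a * b * (a * b) ^ℚ k            ≡⟨ cong (a * b *_) (^ℚ-distribʳ-* a b k) ⟩
  a * b * (a ^ℚ k * b ^ℚ k)       ≡⟨ solve 4 (λ a b c d → a :* b :* (c :* d) := a :* c :* (b :* d)) refl a b _ _ ⟩
  a * a ^ℚ k * (b * b ^ℚ k)       ∎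

1^ℚk≡1 : ∀ k → 1ℚ ^ℚ k ≡ 1ℚ
1^ℚk≡1 zero    = refl
1^ℚk≡1 (suc k) = trans (*-identityˡ _) (1^ℚk≡1 k)

infixr 8 [_]·_

[_]·_ : Bool → ℚ → ℚ
[ b ]· q = if b then q else 0ℚ

[]·-zero : ∀ b → [ b ]· 0ℚ ≡ 0ℚ
[]·-zero true  = refl
[]·-zero false = refl

[]·-*-comm : ∀ b a q → [ b ]· (a * q) ≡ a * [ b ]· q
[]·-*-comm true  a q = refl
[]·-*-comm false a q = sym (*-zeroʳ a)

[]·-distrib-+ : ∀ b p q → [ b ]· (p + q) ≡ [ b ]· p + [ b ]· q
[]·-distrib-+ true  p q = refl
[]·-distrib-+ false p q = sym (+-identityʳ 0ℚ)

[]·-∧ : ∀ a b q → [ a ]· [ b ]· q ≡ [ a ∧ b ]· q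
[]·-∧ true  b q = refl
[]·-∧ false b q = refl

[]·-sum : ∀ b (g : Fin m → ℚ) → [ b ]· sum g ≡ sum (λ i → [ b ]· g i)
[]·-sum     true  g = refl
[]·-sum {m} false g = sym (sum-replicate-zero m)

-- Subsets of Fin n

remove : Subset n → Fin n → Subset n
remove (b ∷ᵥ S) zero    = false ∷ᵥ S
remove (b ∷ᵥ S) (suc j) = b ∷ᵥ remove S j

sumOver : Subset n → (Fin n → ℚ) → ℚ
sumOver S f = sum (λ i → [ lookup S i ]· f i)

infix 5 sumOver
syntax sumOver S (λ i → e) = ∑[ i ∈ S ] e

monomial : (Fin n → ℚ) → Subset n → ℚ
monomial x []ᵥ      = 1ℚ
monomial x (b ∷ᵥ S) = (if b then x zero else 1ℚ) * monomial (λ i → x (suc i)) S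

lookup-remove-self : ∀ (S : Subset n) j → lookup (remove S j) j ≡ false
lookup-remove-self (b ∷ᵥ S) zero    = refl
lookup-remove-self (b ∷ᵥ S) (suc j) = lookup-remove-self S j

lookup-remove-≢ : ∀ (S : Subset n) {i j} → i ≢ j → lookup (remove S i) j ≡ lookup S j
lookup-remove-≢ (b ∷ᵥ S) {zero}  {zero}  i≢j = ⊥-elim (i≢j refl)
lookup-remove-≢ (b ∷ᵥ S) {zero}  {suc j} i≢j = refl
lookup-remove-≢ (b ∷ᵥ S) {suc i} {zero}  i≢j = refl
lookup-remove-≢ (b ∷ᵥ S) {suc i} {suc j} i≢j = lookup-remove-≢ S (λ i≡j → i≢j (cong suc i≡j))

lookup-remove-true : ∀ (S : Subset n) j i → lookup (remove S j) i ≡ true → lookup S i ≡ true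
lookup-remove-true (b ∷ᵥ S) zero    (suc i) e = e
lookup-remove-true (b ∷ᵥ S) (suc j) zero    e = e
lookup-remove-true (b ∷ᵥ S) (suc j) (suc i) e = lookup-remove-true S j i e

remove-comm : ∀ (S : Subset n) i j → remove (remove S i) j ≡ remove (remove S j) i
remove-comm (b ∷ᵥ S) zero    zero    = refl
remove-comm (b ∷ᵥ S) zero    (suc j) = refl
remove-comm (b ∷ᵥ S) (suc i) zero    = refl
remove-comm (b ∷ᵥ S) (suc i) (suc j) = cong (b ∷ᵥ_) (remove-comm S i j)

lookup-remove-sym : ∀ (S : Subset n) i j →
  lookup S i ∧ lookup (remove S i) j ≡ lookup S j ∧ lookup (remove S j) i
lookup-remove-sym (b ∷ᵥ S) zero    zero    = refl
lookup-remove-sym (b ∷ᵥ S) zero    (suc j) = ∧-comm b (lookup S j)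
lookup-remove-sym (b ∷ᵥ S) (suc i) zero    = ∧-comm (lookup S i) b
lookup-remove-sym (b ∷ᵥ S) (suc i) (suc j) = lookup-remove-sym S i j

∣S∣≡1+∣remove∣ : ∀ (S : Subset n) j → lookup S j ≡ true → ∣ S ∣ ≡ suc ∣ remove S j ∣
∣S∣≡1+∣remove∣ (true  ∷ᵥ S) zero    _ = refl
∣S∣≡1+∣remove∣ (true  ∷ᵥ S) (suc j) e = cong suc (∣S∣≡1+∣remove∣ S j e)
∣S∣≡1+∣remove∣ (false ∷ᵥ S) (suc j) e = ∣S∣≡1+∣remove∣ S j e

∣remove∣ : ∀ (S : Subset n) {m} j → ∣ S ∣ ≡ suc m → lookup S j ≡ true → ∣ remove S j ∣ ≡ m
∣remove∣ S j ∣S∣≡1+m j∈S = ℕ.suc-injective (trans (sym (∣S∣≡1+∣remove∣ S j j∈S)) ∣S∣≡1+m)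

nonempty-member : ∀ (S : Subset n) {m} → ∣ S ∣ ≡ suc m → Σ (Fin n) (λ j → lookup S j ≡ true)
nonempty-member (true  ∷ᵥ S) _ = zero , refl
nonempty-member (false ∷ᵥ S) e with nonempty-member S e
... | j , j∈S = suc j , j∈S

lookup-empty : ∀ (S : Subset n) j → ∣ S ∣ ≡ 0 → lookup S j ≢ true
lookup-empty (false ∷ᵥ S) (suc j) e = lookup-empty S j e

sumOver-cong : ∀ (S : Subset n) {f g : Fin n → ℚ} →
  (∀ i → lookup S i ≡ true → f i ≡ g i) → sumOver S f ≡ sumOver S g
sumOver-cong S {f} {g} f≡g = sum-cong-≗ pointwise
  where
  pointwise : ∀ i → [ lookup S i ]· f i ≡ [ lookup S i ]· g i
  pointwise i with lookup S i in i∈S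
  ... | true  = f≡g i i∈S
  ... | false = refl

*-distribˡ-sumOver : ∀ (S : Subset n) a (f : Fin n → ℚ) → a * sumOver S f ≡ ∑[ i ∈ S ] a * f i
*-distribˡ-sumOver S a f = trans (*-distribˡ-sum a (λ i → [ lookup S i ]· f i))
  (sum-cong-≗ (λ i → sym ([]·-*-comm (lookup S i) a (f i))))

sumOver-distrib-+ : ∀ (S : Subset n) (f g : Fin n → ℚ) →
  ∑[ i ∈ S ] (f i + g i) ≡ sumOver S f + sumOver S g
sumOver-distrib-+ S f g = trans (sum-cong-≗ (λ i → []·-distrib-+ (lookup S i) (f i) (g i)))
  (∑-distrib-+ (λ i → [ lookup S i ]· f i) (λ i → [ lookup S i ]· g i))

sumOver-empty : ∀ (S : Subset n) (f : Fin n → ℚ) → ∣ S ∣ ≡ 0 → sumOver S f ≡ 0ℚ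
sumOver-empty []ᵥ           f _ = refl
sumOver-empty (false ∷ᵥ S) f e = trans (+-identityˡ _) (sumOver-empty S (λ i → f (suc i)) e)

sumOver-remove : ∀ (S : Subset n) j (f : Fin n → ℚ) → lookup S j ≡ true →
  sumOver S f ≡ f j + sumOver (remove S j) f
sumOver-remove (true ∷ᵥ S) zero    f _ = cong (f zero +_) (sym (+-identityˡ _))
sumOver-remove (b ∷ᵥ S)    (suc j) f e = begin
  [ b ]· f zero + sumOver S f′                ≡⟨ cong ([ b ]· f zero +_) (sumOver-remove S j f′ e) ⟩
  [ b ]· f zero + (f′ j + sumOver (remove S j) f′)
    ≡⟨ solve 3 (λ a b c → a :+ (b :+ c) := b :+ (a :+ c)) refl ([ b ]· f zero) (f′ j) _ ⟩
  f′ j + ([ b ]· f zero + sumOver (remove S j) f′) ∎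
  where f′ = λ i → f (suc i)

sumOver-comm-remove : ∀ (S : Subset n) (F : Fin n → Fin n → ℚ) →
  ∑[ i ∈ S ] ∑[ j ∈ remove S i ] F i j ≡ ∑[ j ∈ S ] ∑[ i ∈ remove S j ] F i j
sumOver-comm-remove S F = begin
  sum (λ i → [ lookup S i ]· sum (λ j → [ lookup (remove S i) j ]· F i j))
    ≡⟨ sum-cong-≗ (λ i → []·-sum (lookup S i) (λ j → [ lookup (remove S i) j ]· F i j)) ⟩
  sum (λ i → sum (λ j → [ lookup S i ]· [ lookup (remove S i) j ]· F i j))
    ≡⟨ ∑-comm (λ i j → [ lookup S i ]· [ lookup (remove S i) j ]· F i j) ⟩
  sum (λ j → sum (λ i → [ lookup S i ]· [ lookup (remove S i) j ]· F i j))
    ≡⟨ sum-cong-≗ (λ j → sum-cong-≗ (λ i → swap i j)) ⟩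
  sum (λ j → sum (λ i → [ lookup S j ]· [ lookup (remove S j) i ]· F i j))
    ≡⟨ sum-cong-≗ (λ j → sym ([]·-sum (lookup S j) (λ i → [ lookup (remove S j) i ]· F i j))) ⟩
  sum (λ j → [ lookup S j ]· sum (λ i → [ lookup (remove S j) i ]· F i j)) ∎
  where
  swap : ∀ i j → [ lookup S i ]· [ lookup (remove S i) j ]· F i j
               ≡ [ lookup S j ]· [ lookup (remove S j) i ]· F i j
  swap i j = begin
    [ lookup S i ]· [ lookup (remove S i) j ]· F i j   ≡⟨ []·-∧ (lookup S i) _ _ ⟩
    [ lookup S i ∧ lookup (remove S i) j ]· F i j      ≡⟨ cong ([_]· F i j) (lookup-remove-sym S i j) ⟩
    [ lookup S j ∧ lookup (remove S j) i ]· F i j      ≡⟨ sym ([]·-∧ (lookup S j) _ _) ⟩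
    [ lookup S j ]· [ lookup (remove S j) i ]· F i j   ∎

monomial-remove : ∀ (x : Fin n → ℚ) (S : Subset n) j → lookup S j ≡ true →
  monomial x S ≡ x j * monomial x (remove S j)
monomial-remove x (true ∷ᵥ S) zero    _ = cong (x zero *_) (sym (*-identityˡ _))
monomial-remove x (b ∷ᵥ S)    (suc j) e = begin
  x₀ * monomial x′ S                        ≡⟨ cong (x₀ *_) (monomial-remove x′ S j e) ⟩
  x₀ * (x′ j * monomial x′ (remove S j))    ≡⟨ solve 3 (λ a b c → a :* (b :* c) := b :* (a :* c)) refl x₀ (x′ j) _ ⟩
  x′ j * (x₀ * monomial x′ (remove S j))    ∎
  where
  x′ = λ i → x (suc i)
  x₀ = if b then x zero else 1ℚ

monomial-empty : ∀ (x : Fin n → ℚ) (S : Subset n) → ∣ S ∣ ≡ 0 → monomial x S ≡ 1ℚ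
monomial-empty x []ᵥ           _ = refl
monomial-empty x (false ∷ᵥ S) e = trans (*-identityˡ _) (monomial-empty (λ i → x (suc i)) S e)

sumOver-singleton : ∀ (S : Subset n) j (f : Fin n → ℚ) → ∣ S ∣ ≡ 1 → lookup S j ≡ true → sumOver S f ≡ f j
sumOver-singleton S j f ∣S∣≡1 j∈S = begin
  sumOver S f                    ≡⟨ sumOver-remove S j f j∈S ⟩
  f j + sumOver (remove S j) f   ≡⟨ cong (f j +_) (sumOver-empty (remove S j) f (∣remove∣ S j ∣S∣≡1 j∈S)) ⟩
  f j + 0ℚ                       ≡⟨ +-identityʳ (f j) ⟩
  f j                            ∎

monomial-singleton : ∀ (x : Fin n → ℚ) (S : Subset n) j → ∣ S ∣ ≡ 1 → lookup S j ≡ true → monomial x S ≡ x j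
monomial-singleton x S j ∣S∣≡1 j∈S = begin
  monomial x S                  ≡⟨ monomial-remove x S j j∈S ⟩
  x j * monomial x (remove S j) ≡⟨ cong (x j *_) (monomial-empty x (remove S j) (∣remove∣ S j ∣S∣≡1 j∈S)) ⟩
  x j * 1ℚ                      ≡⟨ *-identityʳ (x j) ⟩
  x j                           ∎

-- Sums over the orderings of a subset

Weight : ℕ → Set
Weight n = ℕ → ℚ → Fin n → ℚ

module Orderings (x : Fin n → ℚ) where

  -- For m = ∣ S ∣ this is the sum, over all orderings (i₁, …, iₘ) of S, of
  -- ∏ₖ φ (m - k + 1) (c · x_{i₁} ⋯ x_{iₖ}) iₖ.
  orderSumFrom : Weight n → ℕ → ℚ → Subset n → ℚ
  orderSumFrom φ zero    c S = 1ℚ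
  orderSumFrom φ (suc m) c S = ∑[ i ∈ S ] φ (suc m) (c * x i) i * orderSumFrom φ m (c * x i) (remove S i)

  orderSumFrom-cong : ∀ {φ φ′ : Weight n} → (∀ e P i → φ e P i ≡ φ′ e P i) →
    ∀ m c S → orderSumFrom φ m c S ≡ orderSumFrom φ′ m c S
  orderSumFrom-cong φ≡φ′ zero    c S = refl
  orderSumFrom-cong φ≡φ′ (suc m) c S = sumOver-cong S (λ i _ →
    cong₂ _*_ (φ≡φ′ (suc m) (c * x i) i) (orderSumFrom-cong φ≡φ′ m (c * x i) (remove S i)))

  -- Splitting off the last element j of an ordering of S: its weight has exponent 1 and prefix
  -- product c · monomial x S, independently of the order of the other elements.
  orderSumFrom-last : ∀ (φ : Weight n) (ψ : Fin n → ℚ → ℚ) →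
    (∀ i P → 1ℚ - P ≢ 0ℚ → (1ℚ - P) * φ 1 P i ≡ ψ i P) →
    ∀ m c S → ∣ S ∣ ≡ suc m → 1ℚ - c * monomial x S ≢ 0ℚ →
    (1ℚ - c * monomial x S) * orderSumFrom φ (suc m) c S
      ≡ ∑[ j ∈ S ] ψ j (c * monomial x S) * orderSumFrom (φ ∘ suc) m c (remove S j)
  orderSumFrom-last φ ψ lastWeight zero c S ∣S∣≡1 nz with nonempty-member S ∣S∣≡1
  ... | i , i∈S = begin
    (1ℚ - Q) * (∑[ i ∈ S ] φ 1 (c * x i) i * 1ℚ)
      ≡⟨ cong₂ (λ P s → (1ℚ - P) * s) Q≡cxᵢ (sumOver-singleton S i _ ∣S∣≡1 i∈S) ⟩
    (1ℚ - c * x i) * (φ 1 (c * x i) i * 1ℚ)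
      ≡⟨ cong ((1ℚ - c * x i) *_) (*-identityʳ _) ⟩
    (1ℚ - c * x i) * φ 1 (c * x i) i
      ≡⟨ lastWeight i (c * x i) (λ e → nz (trans (cong (λ P → 1ℚ - P) Q≡cxᵢ) e)) ⟩
    ψ i (c * x i)
      ≡⟨ sym (trans (cong (λ P → ψ i P * 1ℚ) Q≡cxᵢ) (*-identityʳ _)) ⟩
    ψ i Q * 1ℚ
      ≡⟨ sym (sumOver-singleton S i _ ∣S∣≡1 i∈S) ⟩
    ∑[ j ∈ S ] ψ j Q * 1ℚ ∎
    where
    Q = c * monomial x S
    Q≡cxᵢ : Q ≡ c * x i
    Q≡cxᵢ = cong (c *_) (monomial-singleton x S i ∣S∣≡1 i∈S)
  orderSumFrom-last φ ψ lastWeight (suc m) c S ∣S∣≡2+m nz = begin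
    (1ℚ - Q) * (∑[ i ∈ S ] φ′ i * W i)
      ≡⟨ *-distribˡ-sumOver S (1ℚ - Q) _ ⟩
    ∑[ i ∈ S ] (1ℚ - Q) * (φ′ i * W i)
      ≡⟨ sumOver-cong S peel ⟩
    ∑[ i ∈ S ] ∑[ j ∈ remove S i ] F i j
      ≡⟨ sumOver-comm-remove S F ⟩
    ∑[ j ∈ S ] ∑[ i ∈ remove S j ] F i j
      ≡⟨ sumOver-cong S (λ j _ → sym (*-distribˡ-sumOver (remove S j) (ψ j Q) _)) ⟩
    ∑[ j ∈ S ] ψ j Q * orderSumFrom (φ ∘ suc) (suc m) c (remove S j) ∎
    where
    Q = c * monomial x S
    φ′ = λ i → φ (suc (suc m)) (c * x i) i
    W = λ i → orderSumFrom φ (suc m) (c * x i) (remove S i)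
    F = λ i j → ψ j Q * (φ′ i * orderSumFrom (φ ∘ suc) m (c * x i) (remove (remove S j) i))
    Q≡ : ∀ i → lookup S i ≡ true → Q ≡ c * x i * monomial x (remove S i)
    Q≡ i i∈S = trans (cong (c *_) (monomial-remove x S i i∈S)) (sym (*-assoc c (x i) _))
    peel : ∀ i → lookup S i ≡ true → (1ℚ - Q) * (φ′ i * W i) ≡ ∑[ j ∈ remove S i ] F i j
    peel i i∈S = begin
      (1ℚ - Q) * (φ′ i * W i)
        ≡⟨ solve 3 (λ a b w → a :* (b :* w) := b :* (a :* w)) refl (1ℚ - Q) (φ′ i) (W i) ⟩
      φ′ i * ((1ℚ - Q) * W i)
        ≡⟨ cong (λ P → φ′ i * ((1ℚ - P) * W i)) (Q≡ i i∈S) ⟩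
      φ′ i * ((1ℚ - Qᵢ) * W i)
        ≡⟨ cong (φ′ i *_) (orderSumFrom-last φ ψ lastWeight m (c * x i) (remove S i)
             (∣remove∣ S i ∣S∣≡2+m i∈S) (λ e → nz (trans (cong (λ P → 1ℚ - P) (Q≡ i i∈S)) e))) ⟩
      φ′ i * (∑[ j ∈ remove S i ] ψ j Qᵢ * orderSumFrom (φ ∘ suc) m (c * x i) (remove (remove S i) j))
        ≡⟨ *-distribˡ-sumOver (remove S i) (φ′ i) _ ⟩
      ∑[ j ∈ remove S i ] φ′ i * (ψ j Qᵢ * orderSumFrom (φ ∘ suc) m (c * x i) (remove (remove S i) j))
        ≡⟨ sumOver-cong (remove S i) (λ j _ →
             trans (cong₂ (λ P T → φ′ i * (ψ j P * orderSumFrom (φ ∘ suc) m (c * x i) T))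
                          (sym (Q≡ i i∈S)) (remove-comm S i j))
                   (solve 3 (λ a b w → a :* (b :* w) := b :* (a :* w)) refl (φ′ i) (ψ j Q) _)) ⟩
      ∑[ j ∈ remove S i ] F i j ∎
      where Qᵢ = c * x i * monomial x (remove S i)

  orderSum : Weight n → Subset n → ℚ
  orderSum φ S = orderSumFrom φ ∣ S ∣ 1ℚ S

  NonvanishingDenominators : Set
  NonvanishingDenominators = ∀ (S : Subset n) {m} → ∣ S ∣ ≡ suc m → 1ℚ - monomial x S ≢ 0ℚ

  orderSum-recurrence : NonvanishingDenominators → ∀ (φ φ′ : Weight n) (ψ : Fin n → ℚ → ℚ) →
    (∀ i P → 1ℚ - P ≢ 0ℚ → (1ℚ - P) * φ 1 P i ≡ ψ i P) →
    (∀ e P i → φ (suc e) P i ≡ φ′ e P i) →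
    ∀ S → (1ℚ - monomial x S) * orderSum φ S ≡ ∑[ j ∈ S ] ψ j (monomial x S) * orderSum φ′ (remove S j)
  orderSum-recurrence nz φ φ′ ψ lastWeight shift S with ∣ S ∣ in ∣S∣≡
  ... | zero = begin
    (1ℚ - monomial x S) * 1ℚ  ≡⟨ cong (λ X → (1ℚ - X) * 1ℚ) (monomial-empty x S ∣S∣≡) ⟩
    (1ℚ - 1ℚ) * 1ℚ            ≡⟨ solve 0 ((con 1ℚ :- con 1ℚ) :* con 1ℚ := con 0ℚ) refl ⟩
    0ℚ                        ≡⟨ sym (sumOver-empty S _ ∣S∣≡) ⟩
    (∑[ j ∈ S ] ψ j (monomial x S) * orderSum φ′ (remove S j)) ∎
  ... | suc m = begin
    (1ℚ - X) * orderSumFrom φ (suc m) 1ℚ S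
      ≡⟨ cong (λ P → (1ℚ - P) * orderSumFrom φ (suc m) 1ℚ S) (sym (*-identityˡ X)) ⟩
    (1ℚ - 1ℚ * X) * orderSumFrom φ (suc m) 1ℚ S
      ≡⟨ orderSumFrom-last φ ψ lastWeight m 1ℚ S ∣S∣≡
           (λ e → nz S ∣S∣≡ (trans (cong (λ P → 1ℚ - P) (sym (*-identityˡ X))) e)) ⟩
    (∑[ j ∈ S ] ψ j (1ℚ * X) * orderSumFrom (φ ∘ suc) m 1ℚ (remove S j))
      ≡⟨ sumOver-cong S (λ j j∈S → cong₂ (λ P W → ψ j P * W) (*-identityˡ X) (shifted j j∈S)) ⟩
    (∑[ j ∈ S ] ψ j X * orderSum φ′ (remove S j)) ∎
    where
    X = monomial x S
    shifted : ∀ j → lookup S j ≡ true → orderSumFrom (φ ∘ suc) m 1ℚ (remove S j) ≡ orderSum φ′ (remove S j)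
    shifted j j∈S = trans (orderSumFrom-cong shift m 1ℚ (remove S j))
      (cong (λ k → orderSumFrom φ′ k 1ℚ (remove S j)) (sym (∣remove∣ S j ∣S∣≡ j∈S)))

  SatisfiesRecurrence : (ℕ → Fin n → Subset n → ℚ) → (ℕ → Subset n → ℚ) → Set
  SatisfiesRecurrence κ F =
    ∀ t S → (1ℚ - monomial x S) * F t S ≡ ∑[ j ∈ S ] κ t j S * F (suc t) (remove S j)

  recurrence-unique : NonvanishingDenominators → ∀ κ (F G : ℕ → Subset n → ℚ) →
    (∀ t S → ∣ S ∣ ≡ 0 → F t S ≡ G t S) →
    SatisfiesRecurrence κ F → SatisfiesRecurrence κ G → ∀ t S → F t S ≡ G t S
  recurrence-unique nz κ F G base recF recG t S = go ∣ S ∣ t S refl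
    where
    go : ∀ m t S → ∣ S ∣ ≡ m → F t S ≡ G t S
    go zero    t S ∣S∣≡0   = base t S ∣S∣≡0
    go (suc m) t S ∣S∣≡1+m = *-cancelˡ-≢0 (1ℚ - monomial x S) (nz S ∣S∣≡1+m) (begin
      (1ℚ - monomial x S) * F t S                    ≡⟨ recF t S ⟩
      (∑[ j ∈ S ] κ t j S * F (suc t) (remove S j))  ≡⟨ sumOver-cong S (λ j j∈S → cong (κ t j S *_)
                                                          (go m (suc t) (remove S j) (∣remove∣ S j ∣S∣≡1+m j∈S))) ⟩
      (∑[ j ∈ S ] κ t j S * G (suc t) (remove S j))  ≡⟨ sym (recG t S) ⟩
      (1ℚ - monomial x S) * G t S                    ∎)

-- Subset convolution

infix 4 _⊆ᵇ_

_⊆ᵇ_ : Subset n → Subset n → Bool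
[]ᵥ      ⊆ᵇ []ᵥ      = true
(u ∷ᵥ U) ⊆ᵇ (s ∷ᵥ S) = (not u ∨ s) ∧ (U ⊆ᵇ S)

⊆ᵇ-remove : ∀ (U S : Subset n) j → lookup U j ≡ true → (U ⊆ᵇ S) ≡ lookup S j ∧ (remove U j ⊆ᵇ remove S j)
⊆ᵇ-remove (true ∷ᵥ U) (s ∷ᵥ S) zero    _ = refl
⊆ᵇ-remove (u ∷ᵥ U)    (s ∷ᵥ S) (suc j) e =
  trans (cong ((not u ∨ s) ∧_) (⊆ᵇ-remove U S j e)) (∧-left-comm (not u ∨ s) (lookup S j) _)

⊆ᵇ-remove-member : ∀ (U S : Subset n) j → lookup U j ≡ true → (U ⊆ᵇ remove S j) ≡ false
⊆ᵇ-remove-member (true ∷ᵥ U) (s ∷ᵥ S) zero    _ = refl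
⊆ᵇ-remove-member (u ∷ᵥ U)    (s ∷ᵥ S) (suc j) e =
  trans (cong ((not u ∨ s) ∧_) (⊆ᵇ-remove-member U S j e)) (∧-zeroʳ (not u ∨ s))

⊆ᵇ-∧-lookup-─ : ∀ (U S : Subset n) j → (U ⊆ᵇ S) ∧ lookup (S ─ U) j ≡ lookup S j ∧ (U ⊆ᵇ remove S j)
⊆ᵇ-∧-lookup-─ (true  ∷ᵥ U) (s     ∷ᵥ S) zero = trans (∧-zeroʳ _) (sym (∧-zeroʳ s))
⊆ᵇ-∧-lookup-─ (false ∷ᵥ U) (true  ∷ᵥ S) zero = ∧-identityʳ _
⊆ᵇ-∧-lookup-─ (false ∷ᵥ U) (false ∷ᵥ S) zero = ∧-zeroʳ _
⊆ᵇ-∧-lookup-─ (u ∷ᵥ U)     (s ∷ᵥ S)    (suc j) = begin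
  ((not u ∨ s) ∧ (U ⊆ᵇ S)) ∧ lookup (S ─ U) j   ≡⟨ ∧-assoc (not u ∨ s) _ _ ⟩
  (not u ∨ s) ∧ ((U ⊆ᵇ S) ∧ lookup (S ─ U) j)   ≡⟨ cong ((not u ∨ s) ∧_) (⊆ᵇ-∧-lookup-─ U S j) ⟩
  (not u ∨ s) ∧ (lookup S j ∧ (U ⊆ᵇ remove S j)) ≡⟨ ∧-left-comm (not u ∨ s) (lookup S j) _ ⟩
  lookup S j ∧ ((not u ∨ s) ∧ (U ⊆ᵇ remove S j)) ∎

─-remove-member : ∀ (U S : Subset n) j → lookup U j ≡ true → S ─ U ≡ remove S j ─ remove U j
─-remove-member (true ∷ᵥ U) (s ∷ᵥ S) zero    _ = refl
─-remove-member (u ∷ᵥ U)    (s ∷ᵥ S) (suc j) e = cong₂ _∷ᵥ_ refl (─-remove-member U S j e)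

remove-─ : ∀ (U S : Subset n) j → remove (S ─ U) j ≡ remove S j ─ U
remove-─ (true  ∷ᵥ U) (s ∷ᵥ S) zero    = refl
remove-─ (false ∷ᵥ U) (s ∷ᵥ S) zero    = refl
remove-─ (true  ∷ᵥ U) (s ∷ᵥ S) (suc j) = cong (false ∷ᵥ_) (remove-─ U S j)
remove-─ (false ∷ᵥ U) (s ∷ᵥ S) (suc j) = cong (s ∷ᵥ_) (remove-─ U S j)

─-self-empty : ∀ (S : Subset n) → ∣ S ─ S ∣ ≡ 0
─-self-empty []ᵥ          = refl
─-self-empty (true  ∷ᵥ S) = ─-self-empty S
─-self-empty (false ∷ᵥ S) = ─-self-empty S

monomial-─ : ∀ (x : Fin n → ℚ) (U S : Subset n) → (U ⊆ᵇ S) ≡ true →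
  monomial x S ≡ monomial x U * monomial x (S ─ U)
monomial-─ x []ᵥ []ᵥ U⊆S = sym (*-identityʳ 1ℚ)
monomial-─ x (true  ∷ᵥ U) (true  ∷ᵥ S) U⊆S = begin
  x zero * monomial x′ S                         ≡⟨ cong (x zero *_) (monomial-─ x′ U S U⊆S) ⟩
  x zero * (monomial x′ U * monomial x′ (S ─ U))
    ≡⟨ solve 3 (λ a b c → a :* (b :* c) := a :* b :* (con 1ℚ :* c)) refl (x zero) (monomial x′ U) (monomial x′ (S ─ U)) ⟩
  x zero * monomial x′ U * (1ℚ * monomial x′ (S ─ U)) ∎
  where x′ = λ i → x (suc i)
monomial-─ x (false ∷ᵥ U) (s ∷ᵥ S) U⊆S = begin
  x₀ * monomial x′ S                         ≡⟨ cong (x₀ *_) (monomial-─ x′ U S U⊆S) ⟩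
  x₀ * (monomial x′ U * monomial x′ (S ─ U))
    ≡⟨ solve 3 (λ a b c → a :* (b :* c) := con 1ℚ :* b :* (a :* c)) refl x₀ (monomial x′ U) (monomial x′ (S ─ U)) ⟩
  1ℚ * monomial x′ U * (x₀ * monomial x′ (S ─ U)) ∎
  where
  x′ = λ i → x (suc i)
  x₀ = if s then x zero else 1ℚ

sumSubsets : (Subset n → ℚ) → ℚ
sumSubsets {zero}  g = g []ᵥ
sumSubsets {suc n} g = sumSubsets (λ U → g (true ∷ᵥ U)) + sumSubsets (λ U → g (false ∷ᵥ U))

sumSubsets-cong : ∀ {f g : Subset n → ℚ} → (∀ U → f U ≡ g U) → sumSubsets f ≡ sumSubsets g
sumSubsets-cong {zero}  f≡g = f≡g []ᵥ
sumSubsets-cong {suc n} f≡g =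
  cong₂ _+_ (sumSubsets-cong (λ U → f≡g (true ∷ᵥ U))) (sumSubsets-cong (λ U → f≡g (false ∷ᵥ U)))

sumSubsets-zero : sumSubsets {n} (λ _ → 0ℚ) ≡ 0ℚ
sumSubsets-zero {zero}  = refl
sumSubsets-zero {suc n} = trans (cong₂ _+_ (sumSubsets-zero {n}) (sumSubsets-zero {n})) (+-identityʳ 0ℚ)

sumSubsets-distrib-+ : ∀ (f g : Subset n → ℚ) → sumSubsets (λ U → f U + g U) ≡ sumSubsets f + sumSubsets g
sumSubsets-distrib-+ {zero}  f g = refl
sumSubsets-distrib-+ {suc n} f g = begin
  sumSubsets (λ U → f (true ∷ᵥ U) + g (true ∷ᵥ U)) + sumSubsets (λ U → f (false ∷ᵥ U) + g (false ∷ᵥ U))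
    ≡⟨ cong₂ _+_ (sumSubsets-distrib-+ (λ U → f (true ∷ᵥ U)) (λ U → g (true ∷ᵥ U)))
                 (sumSubsets-distrib-+ (λ U → f (false ∷ᵥ U)) (λ U → g (false ∷ᵥ U))) ⟩
  sumSubsets (λ U → f (true ∷ᵥ U)) + sumSubsets (λ U → g (true ∷ᵥ U))
    + (sumSubsets (λ U → f (false ∷ᵥ U)) + sumSubsets (λ U → g (false ∷ᵥ U)))
    ≡⟨ solve 4 (λ a b c d → a :+ b :+ (c :+ d) := a :+ c :+ (b :+ d)) refl
         (sumSubsets (λ U → f (true ∷ᵥ U))) (sumSubsets (λ U → g (true ∷ᵥ U)))
         (sumSubsets (λ U → f (false ∷ᵥ U))) (sumSubsets (λ U → g (false ∷ᵥ U))) ⟩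
  sumSubsets f + sumSubsets g ∎

*-distribˡ-sumSubsets : ∀ a (f : Subset n → ℚ) → a * sumSubsets f ≡ sumSubsets (λ U → a * f U)
*-distribˡ-sumSubsets {zero}  a f = refl
*-distribˡ-sumSubsets {suc n} a f = begin
  a * (sumSubsets (λ U → f (true ∷ᵥ U)) + sumSubsets (λ U → f (false ∷ᵥ U)))
    ≡⟨ *-distribˡ-+ a (sumSubsets (λ U → f (true ∷ᵥ U))) _ ⟩
  a * sumSubsets (λ U → f (true ∷ᵥ U)) + a * sumSubsets (λ U → f (false ∷ᵥ U))
    ≡⟨ cong₂ _+_ (*-distribˡ-sumSubsets a (λ U → f (true ∷ᵥ U))) (*-distribˡ-sumSubsets a (λ U → f (false ∷ᵥ U))) ⟩
  sumSubsets (λ U → a * f U) ∎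

sumSubsets-[]· : ∀ b (f : Subset n → ℚ) → sumSubsets (λ U → [ b ]· f U) ≡ [ b ]· sumSubsets f
sumSubsets-[]·     true  f = refl
sumSubsets-[]· {n} false f = sumSubsets-zero {n}

sumSubsets-sum : ∀ {m} (H : Subset n → Fin m → ℚ) → sumSubsets (λ U → sum (H U)) ≡ sum (λ j → sumSubsets (λ U → H U j))
sumSubsets-sum {zero}  H = refl
sumSubsets-sum {suc n} H = trans
  (cong₂ _+_ (sumSubsets-sum (λ U → H (true ∷ᵥ U))) (sumSubsets-sum (λ U → H (false ∷ᵥ U))))
  (sym (∑-distrib-+ (λ j → sumSubsets (λ U → H (true ∷ᵥ U) j)) (λ j → sumSubsets (λ U → H (false ∷ᵥ U) j))))

-- U ↦ remove U j is a bijection from the subsets containing j onto those avoiding j.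
sumSubsets-remove : ∀ (j : Fin n) (g : Subset n → ℚ) →
  sumSubsets (λ U → [ lookup U j ]· g (remove U j)) ≡ sumSubsets (λ U → [ not (lookup U j) ]· g U)
sumSubsets-remove {suc n} zero g = begin
  sumSubsets (λ U → g (false ∷ᵥ U)) + sumSubsets {n} (λ _ → 0ℚ)
    ≡⟨ cong (sumSubsets (λ U → g (false ∷ᵥ U)) +_) (sumSubsets-zero {n}) ⟩
  sumSubsets (λ U → g (false ∷ᵥ U)) + 0ℚ
    ≡⟨ trans (+-identityʳ _) (sym (+-identityˡ (sumSubsets (λ U → g (false ∷ᵥ U))))) ⟩
  0ℚ + sumSubsets (λ U → g (false ∷ᵥ U))
    ≡⟨ cong (_+ sumSubsets (λ U → g (false ∷ᵥ U))) (sym (sumSubsets-zero {n})) ⟩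
  sumSubsets {n} (λ _ → 0ℚ) + sumSubsets (λ U → g (false ∷ᵥ U)) ∎
sumSubsets-remove {suc n} (suc j) g =
  cong₂ _+_ (sumSubsets-remove j (λ U → g (true ∷ᵥ U))) (sumSubsets-remove j (λ U → g (false ∷ᵥ U)))

convolution : (Subset n → Subset n → ℚ) → Subset n → ℚ
convolution g S = sumSubsets (λ U → [ U ⊆ᵇ S ]· g U (S ─ U))

convolution-cong : ∀ (S : Subset n) {f g : Subset n → Subset n → ℚ} →
  (∀ U → (U ⊆ᵇ S) ≡ true → f U (S ─ U) ≡ g U (S ─ U)) → convolution f S ≡ convolution g S
convolution-cong S {f} {g} f≡g = sumSubsets-cong pointwise
  where
  pointwise : ∀ U → [ U ⊆ᵇ S ]· f U (S ─ U) ≡ [ U ⊆ᵇ S ]· g U (S ─ U)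
  pointwise U with U ⊆ᵇ S in U⊆S
  ... | true  = f≡g U U⊆S
  ... | false = refl

*-distribˡ-convolution : ∀ a (g : Subset n → Subset n → ℚ) S →
  a * convolution g S ≡ convolution (λ U V → a * g U V) S
*-distribˡ-convolution a g S = trans (*-distribˡ-sumSubsets a (λ U → [ U ⊆ᵇ S ]· g U (S ─ U)))
  (sumSubsets-cong (λ U → sym ([]·-*-comm (U ⊆ᵇ S) a (g U (S ─ U)))))

convolution-empty : ∀ (g : Subset n → Subset n → ℚ) S → ∣ S ∣ ≡ 0 → convolution g S ≡ g S (S ─ S)
convolution-empty g []ᵥ _ = refl
convolution-empty {suc n} g (false ∷ᵥ S) ∣S∣≡0 = begin
  sumSubsets {n} (λ _ → 0ℚ) + convolution (λ U V → g (false ∷ᵥ U) (false ∷ᵥ V)) S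
    ≡⟨ cong₂ _+_ (sumSubsets-zero {n}) (convolution-empty (λ U V → g (false ∷ᵥ U) (false ∷ᵥ V)) S ∣S∣≡0) ⟩
  0ℚ + g (false ∷ᵥ S) (false ∷ᵥ (S ─ S))
    ≡⟨ +-identityˡ _ ⟩
  g (false ∷ᵥ S) (false ∷ᵥ (S ─ S)) ∎

convolution-removeˡ : ∀ (S : Subset n) (h : Fin n → Subset n → Subset n → ℚ) →
  convolution (λ U V → ∑[ j ∈ U ] h j (remove U j) V) S ≡ ∑[ j ∈ S ] convolution (h j) (remove S j)
convolution-removeˡ {n} S h = begin
  sumSubsets (λ U → [ U ⊆ᵇ S ]· sum (λ j → [ lookup U j ]· h j (remove U j) (S ─ U)))
    ≡⟨ sumSubsets-cong (λ U → []·-sum (U ⊆ᵇ S) (λ j → [ lookup U j ]· h j (remove U j) (S ─ U))) ⟩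
  sumSubsets (λ U → sum (λ j → [ U ⊆ᵇ S ]· [ lookup U j ]· h j (remove U j) (S ─ U)))
    ≡⟨ sumSubsets-sum (λ U j → [ U ⊆ᵇ S ]· [ lookup U j ]· h j (remove U j) (S ─ U)) ⟩
  sum (λ j → sumSubsets (λ U → [ U ⊆ᵇ S ]· [ lookup U j ]· h j (remove U j) (S ─ U)))
    ≡⟨ sum-cong-≗ term ⟩
  sum (λ j → [ lookup S j ]· convolution (h j) (remove S j)) ∎
  where
  term : ∀ j → sumSubsets (λ U → [ U ⊆ᵇ S ]· [ lookup U j ]· h j (remove U j) (S ─ U))
             ≡ [ lookup S j ]· convolution (h j) (remove S j)
  term j = begin
    sumSubsets (λ U → [ U ⊆ᵇ S ]· [ lookup U j ]· h j (remove U j) (S ─ U))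
      ≡⟨ sumSubsets-cong withJ ⟩
    sumSubsets (λ U → [ lookup U j ]· G (remove U j))
      ≡⟨ sumSubsets-remove j G ⟩
    sumSubsets (λ U → [ not (lookup U j) ]· G U)
      ≡⟨ sumSubsets-cong withoutJ ⟩
    sumSubsets (λ U → [ lookup S j ]· [ U ⊆ᵇ S′ ]· h j U (S′ ─ U))
      ≡⟨ sumSubsets-[]· (lookup S j) (λ U → [ U ⊆ᵇ S′ ]· h j U (S′ ─ U)) ⟩
    [ lookup S j ]· convolution (h j) S′ ∎
    where
    S′ = remove S j
    G : Subset n → ℚ
    G U = [ lookup S j ∧ (U ⊆ᵇ S′) ]· h j U (S′ ─ U)
    withJ : ∀ U → [ U ⊆ᵇ S ]· [ lookup U j ]· h j (remove U j) (S ─ U) ≡ [ lookup U j ]· G (remove U j)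
    withJ U with lookup U j in j∈U
    ... | true  = cong₂ (λ b V → [ b ]· h j (remove U j) V) (⊆ᵇ-remove U S j j∈U) (─-remove-member U S j j∈U)
    ... | false = []·-zero (U ⊆ᵇ S)
    withoutJ : ∀ U → [ not (lookup U j) ]· G U ≡ [ lookup S j ]· [ U ⊆ᵇ S′ ]· h j U (S′ ─ U)
    withoutJ U with lookup U j in j∈U
    ... | true  = sym (trans (cong (λ b → [ lookup S j ]· [ b ]· h j U (S′ ─ U)) (⊆ᵇ-remove-member U S j j∈U))
                             ([]·-zero (lookup S j)))
    ... | false = sym ([]·-∧ (lookup S j) (U ⊆ᵇ S′) _)

convolution-removeʳ : ∀ (S : Subset n) (k : Fin n → Subset n → Subset n → ℚ) →
  convolution (λ U V → ∑[ j ∈ V ] k j U (remove V j)) S ≡ ∑[ j ∈ S ] convolution (k j) (remove S j)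
convolution-removeʳ S k = begin
  sumSubsets (λ U → [ U ⊆ᵇ S ]· sum (λ j → [ lookup (S ─ U) j ]· k j U (remove (S ─ U) j)))
    ≡⟨ sumSubsets-cong (λ U → []·-sum (U ⊆ᵇ S) (λ j → [ lookup (S ─ U) j ]· k j U (remove (S ─ U) j))) ⟩
  sumSubsets (λ U → sum (λ j → [ U ⊆ᵇ S ]· [ lookup (S ─ U) j ]· k j U (remove (S ─ U) j)))
    ≡⟨ sumSubsets-sum (λ U j → [ U ⊆ᵇ S ]· [ lookup (S ─ U) j ]· k j U (remove (S ─ U) j)) ⟩
  sum (λ j → sumSubsets (λ U → [ U ⊆ᵇ S ]· [ lookup (S ─ U) j ]· k j U (remove (S ─ U) j)))
    ≡⟨ sum-cong-≗ (λ j → trans (sumSubsets-cong (reorder j))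
                              (sumSubsets-[]· (lookup S j) (λ U → [ U ⊆ᵇ remove S j ]· k j U (remove S j ─ U)))) ⟩
  sum (λ j → [ lookup S j ]· convolution (k j) (remove S j)) ∎
  where
  reorder : ∀ j U → [ U ⊆ᵇ S ]· [ lookup (S ─ U) j ]· k j U (remove (S ─ U) j)
                  ≡ [ lookup S j ]· [ U ⊆ᵇ remove S j ]· k j U (remove S j ─ U)
  reorder j U = begin
    [ U ⊆ᵇ S ]· [ lookup (S ─ U) j ]· k j U (remove (S ─ U) j)
      ≡⟨ []·-∧ (U ⊆ᵇ S) _ _ ⟩
    [ (U ⊆ᵇ S) ∧ lookup (S ─ U) j ]· k j U (remove (S ─ U) j)
      ≡⟨ cong₂ (λ b V → [ b ]· k j U V) (⊆ᵇ-∧-lookup-─ U S j) (remove-─ U S j) ⟩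
    [ lookup S j ∧ (U ⊆ᵇ remove S j) ]· k j U (remove S j ─ U)
      ≡⟨ sym ([]·-∧ (lookup S j) _ _) ⟩
    [ lookup S j ]· [ U ⊆ᵇ remove S j ]· k j U (remove S j ─ U) ∎

convolution-distrib-+ : ∀ (f g : Subset n → Subset n → ℚ) S →
  convolution (λ U V → f U V + g U V) S ≡ convolution f S + convolution g S
convolution-distrib-+ f g S = trans
  (sumSubsets-cong (λ U → []·-distrib-+ (U ⊆ᵇ S) (f U (S ─ U)) (g U (S ─ U))))
  (sumSubsets-distrib-+ (λ U → [ U ⊆ᵇ S ]· f U (S ─ U)) (λ U → [ U ⊆ᵇ S ]· g U (S ─ U)))

-- A Leibniz rule: if c times each term splits off one element of U or of S ∖ U,
-- then c times the convolution splits off one element of S.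
convolution-recurrence : ∀ c (S : Subset n) (g g′ : Subset n → Subset n → ℚ) (α β : Fin n → ℚ) →
  (∀ U → (U ⊆ᵇ S) ≡ true →
    c * g U (S ─ U) ≡ (∑[ j ∈ U ] (- α j) * g′ (remove U j) (S ─ U))
                    + (∑[ j ∈ S ─ U ] β j * g′ U (remove (S ─ U) j))) →
  c * convolution g S ≡ ∑[ j ∈ S ] (β j - α j) * convolution g′ (remove S j)
convolution-recurrence {n} c S g g′ α β expand = begin
  c * convolution g S
    ≡⟨ *-distribˡ-convolution c g S ⟩
  convolution (λ U V → c * g U V) S
    ≡⟨ convolution-cong S {f = λ U V → c * g U V} {g = λ U V → h U V + k U V} expand ⟩
  convolution (λ U V → h U V + k U V) S
    ≡⟨ convolution-distrib-+ h k S ⟩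
  convolution h S + convolution k S
    ≡⟨ cong₂ _+_ (convolution-removeˡ S (λ j U V → (- α j) * g′ U V))
                 (convolution-removeʳ S (λ j U V → β j * g′ U V)) ⟩
  (∑[ j ∈ S ] hⱼ j) + (∑[ j ∈ S ] kⱼ j)
    ≡⟨ sym (sumOver-distrib-+ S hⱼ kⱼ) ⟩
  (∑[ j ∈ S ] hⱼ j + kⱼ j)
    ≡⟨ sumOver-cong S (λ j _ → combine j) ⟩
  (∑[ j ∈ S ] (β j - α j) * convolution g′ (remove S j)) ∎
  where
  h k : Subset n → Subset n → ℚ
  h U V = ∑[ j ∈ U ] (- α j) * g′ (remove U j) V
  k U V = ∑[ j ∈ V ] β j * g′ U (remove V j)
  hⱼ kⱼ : Fin n → ℚ
  hⱼ j = convolution (λ U V → (- α j) * g′ U V) (remove S j)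
  kⱼ j = convolution (λ U V → β j * g′ U V) (remove S j)
  combine : ∀ j → hⱼ j + kⱼ j ≡ (β j - α j) * convolution g′ (remove S j)
  combine j = trans
    (sym (cong₂ _+_ (*-distribˡ-convolution (- α j) g′ (remove S j)) (*-distribˡ-convolution (β j) g′ (remove S j))))
    (solve 3 (λ a b C → (:- a) :* C :+ b :* C := (b :- a) :* C) refl (α j) (β j) (convolution g′ (remove S j)))

-- The two sides of the identity

module Families (x y : Fin n → ℚ) (nz : Orderings.NonvanishingDenominators x) where
  open Orderings x

  lhsWeight : Weight n
  lhsWeight e P i = (y i - P) /ℚ (1ℚ - P)

  rhsWeight : ℕ → Weight n
  rhsWeight t e P i = (y i - x i ^ℚ (t +ℕ e)) /ℚ (1ℚ - P)

  A B : Subset n → ℚ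
  A = orderSum (λ e P i → (- P) /ℚ (1ℚ - P))
  B = orderSum (λ e P i → y i /ℚ (1ℚ - P))

  term : ℕ → Subset n → Subset n → ℚ
  term t U V = monomial x U ^ℚ t * A U * B V

  C : ℕ → Subset n → ℚ
  C t = convolution (term t)

  lhsCoefficient rhsCoefficient : ℕ → Fin n → Subset n → ℚ
  lhsCoefficient _ j S = y j - monomial x S
  rhsCoefficient t j _ = y j - x j ^ℚ suc t

  lhs-recurrence : SatisfiesRecurrence lhsCoefficient (λ _ → orderSum lhsWeight)
  lhs-recurrence _ = orderSum-recurrence nz lhsWeight lhsWeight (λ j P → y j - P)
    (λ i P 1-P≢0 → q*[p/q]≡p (y i - P) (1ℚ - P) 1-P≢0) (λ _ _ _ → refl)

  rhs-recurrence : SatisfiesRecurrence rhsCoefficient (λ t → orderSum (rhsWeight t))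
  rhs-recurrence t = orderSum-recurrence nz (rhsWeight t) (rhsWeight (suc t)) (λ j _ → y j - x j ^ℚ suc t)
    (λ i P 1-P≢0 → trans (q*[p/q]≡p _ (1ℚ - P) 1-P≢0) (cong (λ k → y i - x i ^ℚ k) (ℕ.+-comm t 1)))
    (λ e P i → cong (λ k → (y i - x i ^ℚ k) /ℚ (1ℚ - P)) (ℕ.+-suc t e))

  A-recurrence : ∀ S → (1ℚ - monomial x S) * A S ≡ ∑[ j ∈ S ] (- monomial x S) * A (remove S j)
  A-recurrence = orderSum-recurrence nz _ _ (λ _ P → - P)
    (λ i P 1-P≢0 → q*[p/q]≡p (- P) (1ℚ - P) 1-P≢0) (λ _ _ _ → refl)

  B-recurrence : ∀ S → (1ℚ - monomial x S) * B S ≡ ∑[ j ∈ S ] y j * B (remove S j)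
  B-recurrence = orderSum-recurrence nz _ _ (λ j _ → y j)
    (λ i P 1-P≢0 → q*[p/q]≡p (y i) (1ℚ - P) 1-P≢0) (λ _ _ _ → refl)

  C-recurrence : SatisfiesRecurrence rhsCoefficient C
  C-recurrence t S = convolution-recurrence (1ℚ - monomial x S) S (term t) (term (suc t)) (λ j → x j ^ℚ suc t) y expand
    where
    expand : ∀ U → (U ⊆ᵇ S) ≡ true →
      (1ℚ - monomial x S) * term t U (S ─ U)
        ≡ (∑[ j ∈ U ] (- x j ^ℚ suc t) * term (suc t) (remove U j) (S ─ U))
        + (∑[ j ∈ S ─ U ] y j * term (suc t) U (remove (S ─ U) j))
    expand U U⊆S = begin
      (1ℚ - monomial x S) * (Xᵗ * A U * B V)
        ≡⟨ cong (λ P → (1ℚ - P) * (Xᵗ * A U * B V)) (monomial-─ x U S U⊆S) ⟩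
      (1ℚ - X * monomial x V) * (Xᵗ * A U * B V)
        ≡⟨ solve 5 (λ X Y p a b → (con 1ℚ :- X :* Y) :* (p :* a :* b)
                                 := b :* p :* ((con 1ℚ :- X) :* a) :+ X :* p :* a :* ((con 1ℚ :- Y) :* b))
             refl X (monomial x V) Xᵗ (A U) (B V) ⟩
      B V * Xᵗ * ((1ℚ - X) * A U) + X * Xᵗ * A U * ((1ℚ - monomial x V) * B V)
        ≡⟨ cong₂ (λ a b → B V * Xᵗ * a + X * Xᵗ * A U * b) (A-recurrence U) (B-recurrence V) ⟩
      B V * Xᵗ * (∑[ j ∈ U ] (- X) * A (remove U j)) + X * Xᵗ * A U * (∑[ j ∈ V ] y j * B (remove V j))
        ≡⟨ cong₂ _+_ (trans (*-distribˡ-sumOver U (B V * Xᵗ) _) (sumOver-cong U left))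
                     (trans (*-distribˡ-sumOver V (X * Xᵗ * A U) _) (sumOver-cong V (λ j _ → right j))) ⟩
      (∑[ j ∈ U ] (- x j ^ℚ suc t) * term (suc t) (remove U j) V) + (∑[ j ∈ V ] y j * term (suc t) U (remove V j)) ∎
      where
      V = S ─ U
      X = monomial x U
      Xᵗ = X ^ℚ t
      left : ∀ j → lookup U j ≡ true →
        B V * Xᵗ * ((- X) * A (remove U j)) ≡ (- x j ^ℚ suc t) * term (suc t) (remove U j) V
      left j j∈U = begin
        B V * X ^ℚ t * ((- X) * A U′)
          ≡⟨ cong (λ P → B V * P ^ℚ t * ((- P) * A U′)) (monomial-remove x U j j∈U) ⟩
        B V * (x j * X′) ^ℚ t * ((- (x j * X′)) * A U′)
          ≡⟨ cong (λ P → B V * P * ((- (x j * X′)) * A U′)) (^ℚ-distribʳ-* (x j) X′ t) ⟩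
        B V * (x j ^ℚ t * X′ ^ℚ t) * ((- (x j * X′)) * A U′)
          ≡⟨ solve 6 (λ b a p q r c → b :* (p :* q) :* ((:- (a :* r)) :* c) := (:- (a :* p)) :* (r :* q :* c :* b))
               refl (B V) (x j) (x j ^ℚ t) (X′ ^ℚ t) X′ (A U′) ⟩
        (- x j ^ℚ suc t) * term (suc t) U′ V ∎
        where
        U′ = remove U j
        X′ = monomial x U′
      right : ∀ j → X * Xᵗ * A U * (y j * B (remove V j)) ≡ y j * term (suc t) U (remove V j)
      right j = solve 4 (λ p a y b → p :* a :* (y :* b) := y :* (p :* a :* b))
                        refl (X * Xᵗ) (A U) (y j) (B (remove V j))

  C₀-recurrence : SatisfiesRecurrence lhsCoefficient (λ _ → C 0)
  C₀-recurrence _ S = convolution-recurrence (1ℚ - monomial x S) S (term 0) (term 0) (λ _ → monomial x S) y expand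
    where
    expand : ∀ U → (U ⊆ᵇ S) ≡ true →
      (1ℚ - monomial x S) * term 0 U (S ─ U)
        ≡ (∑[ j ∈ U ] (- monomial x S) * term 0 (remove U j) (S ─ U))
        + (∑[ j ∈ S ─ U ] y j * term 0 U (remove (S ─ U) j))
    expand U U⊆S = begin
      (1ℚ - monomial x S) * (1ℚ * A U * B V)
        ≡⟨ cong (λ P → (1ℚ - P) * (1ℚ * A U * B V)) X≡ ⟩
      (1ℚ - X * Y) * (1ℚ * A U * B V)
        ≡⟨ solve 4 (λ X Y a b → (con 1ℚ :- X :* Y) :* (con 1ℚ :* a :* b)
                               := Y :* b :* ((con 1ℚ :- X) :* a) :+ con 1ℚ :* a :* ((con 1ℚ :- Y) :* b))
             refl X Y (A U) (B V) ⟩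
      Y * B V * ((1ℚ - X) * A U) + 1ℚ * A U * ((1ℚ - Y) * B V)
        ≡⟨ cong₂ (λ a b → Y * B V * a + 1ℚ * A U * b) (A-recurrence U) (B-recurrence V) ⟩
      Y * B V * (∑[ j ∈ U ] (- X) * A (remove U j)) + 1ℚ * A U * (∑[ j ∈ V ] y j * B (remove V j))
        ≡⟨ cong₂ _+_ (trans (*-distribˡ-sumOver U (Y * B V) _) (sumOver-cong U (λ j _ → left j)))
                     (trans (*-distribˡ-sumOver V (1ℚ * A U) _) (sumOver-cong V (λ j _ → right j))) ⟩
      (∑[ j ∈ U ] (- monomial x S) * term 0 (remove U j) V) + (∑[ j ∈ V ] y j * term 0 U (remove V j)) ∎
      where
      V = S ─ U
      X = monomial x U
      Y = monomial x V
      X≡ : monomial x S ≡ X * Y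
      X≡ = monomial-─ x U S U⊆S
      left : ∀ j → Y * B V * ((- X) * A (remove U j)) ≡ (- monomial x S) * term 0 (remove U j) V
      left j = trans (solve 4 (λ X Y a b → Y :* b :* ((:- X) :* a) := (:- (X :* Y)) :* (con 1ℚ :* a :* b))
                        refl X Y (A (remove U j)) (B V))
                     (cong (λ P → (- P) * term 0 (remove U j) V) (sym X≡))
      right : ∀ j → 1ℚ * A U * (y j * B (remove V j)) ≡ y j * term 0 U (remove V j)
      right j = solve 3 (λ a y b → con 1ℚ :* a :* (y :* b) := y :* (con 1ℚ :* a :* b)) refl (A U) (y j) (B (remove V j))

  orderSum-empty : ∀ φ S → ∣ S ∣ ≡ 0 → orderSum φ S ≡ 1ℚ
  orderSum-empty φ S ∣S∣≡0 = cong (λ m → orderSumFrom φ m 1ℚ S) ∣S∣≡0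

  C-empty : ∀ t S → ∣ S ∣ ≡ 0 → C t S ≡ 1ℚ
  C-empty t S ∣S∣≡0 = begin
    C t S
      ≡⟨ convolution-empty (term t) S ∣S∣≡0 ⟩
    monomial x S ^ℚ t * A S * B (S ─ S)
      ≡⟨ cong₂ (λ P a → P ^ℚ t * a * B (S ─ S)) (monomial-empty x S ∣S∣≡0) (orderSum-empty _ S ∣S∣≡0) ⟩
    1ℚ ^ℚ t * 1ℚ * B (S ─ S)
      ≡⟨ cong₂ (λ p b → p * 1ℚ * b) (1^ℚk≡1 t) (orderSum-empty _ (S ─ S) (─-self-empty S)) ⟩
    1ℚ * 1ℚ * 1ℚ
      ≡⟨ solve 0 (con 1ℚ :* con 1ℚ :* con 1ℚ := con 1ℚ) refl ⟩
    1ℚ ∎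

  lhs≡C₀ : ∀ S → orderSum lhsWeight S ≡ C 0 S
  lhs≡C₀ = recurrence-unique nz lhsCoefficient (λ _ → orderSum lhsWeight) (λ _ → C 0)
    (λ t S ∣S∣≡0 → trans (orderSum-empty lhsWeight S ∣S∣≡0) (sym (C-empty 0 S ∣S∣≡0)))
    lhs-recurrence C₀-recurrence 0

  rhs≡C : ∀ t S → orderSum (rhsWeight t) S ≡ C t S
  rhs≡C = recurrence-unique nz rhsCoefficient (λ t → orderSum (rhsWeight t)) C
    (λ t S ∣S∣≡0 → trans (orderSum-empty (rhsWeight t) S ∣S∣≡0) (sym (C-empty t S ∣S∣≡0)))
    rhs-recurrence C-recurrence

  lhs≡rhs : ∀ S → orderSum lhsWeight S ≡ orderSum (rhsWeight 0) S
  lhs≡rhs S = trans (lhs≡C₀ S) (sym (rhs≡C 0 S))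

-- Permutations as words with distinct letters

sumℚ-++ : ∀ xs ys → sumℚ (xs ++ ys) ≡ sumℚ xs + sumℚ ys
sumℚ-++ []       ys = sym (+-identityˡ _)
sumℚ-++ (a ∷ xs) ys = trans (cong (a +_) (sumℚ-++ xs ys)) (sym (+-assoc a (sumℚ xs) (sumℚ ys)))

sumℚ-map-concatMap : ∀ {A B : Set} (g : B → ℚ) (f : A → List B) xs →
  sumℚ (map g (concatMap f xs)) ≡ sumℚ (map (λ a → sumℚ (map g (f a))) xs)
sumℚ-map-concatMap g f []       = refl
sumℚ-map-concatMap g f (a ∷ xs) = begin
  sumℚ (map g (f a ++ concatMap f xs))                  ≡⟨ cong sumℚ (map-++ g (f a) (concatMap f xs)) ⟩
  sumℚ (map g (f a) ++ map g (concatMap f xs))          ≡⟨ sumℚ-++ (map g (f a)) _ ⟩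
  sumℚ (map g (f a)) + sumℚ (map g (concatMap f xs))    ≡⟨ cong (sumℚ (map g (f a)) +_) (sumℚ-map-concatMap g f xs) ⟩
  sumℚ (map (λ a → sumℚ (map g (f a))) (a ∷ xs))        ∎

sumℚ-map-zero : ∀ {A : Set} (xs : List A) → sumℚ (map (λ _ → 0ℚ) xs) ≡ 0ℚ
sumℚ-map-zero []       = refl
sumℚ-map-zero (a ∷ xs) = trans (+-identityˡ _) (sumℚ-map-zero xs)

*-distribˡ-sumℚ-map : ∀ {A : Set} c (f : A → ℚ) xs → c * sumℚ (map f xs) ≡ sumℚ (map (λ a → c * f a) xs)
*-distribˡ-sumℚ-map c f []       = *-zeroʳ c
*-distribˡ-sumℚ-map c f (a ∷ xs) = trans (*-distribˡ-+ c (f a) _) (cong (c * f a +_) (*-distribˡ-sumℚ-map c f xs))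

sumℚ-map-filter : ∀ {A : Set} {P : A → Set} (P? : Decidable P) (f : A → ℚ) xs →
  sumℚ (map f (filter P? xs)) ≡ sumℚ (map (λ a → [ does (P? a) ]· f a) xs)
sumℚ-map-filter P? f [] = refl
sumℚ-map-filter P? f (a ∷ xs) with does (P? a)
... | true  = cong (f a +_) (sumℚ-map-filter P? f xs)
... | false = trans (sumℚ-map-filter P? f xs) (sym (+-identityˡ _))

map-allFin-suc : ∀ {A : Set} m (g : Fin (suc m) → A) → map g (allFin (suc m)) ≡ g zero ∷ map (g ∘ suc) (allFin m)
map-allFin-suc m g = cong (g zero ∷_) (trans (map-tabulate suc g) (sym (map-tabulate (λ i → i) (g ∘ suc))))

sumℚ-map-allFin : ∀ m (f : Fin m → ℚ) → sumℚ (map f (allFin m)) ≡ sum f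
sumℚ-map-allFin zero    f = refl
sumℚ-map-allFin (suc m) f = trans (cong sumℚ (map-allFin-suc m f)) (cong (f zero +_) (sumℚ-map-allFin m (f ∘ suc)))

remove-excludes : ∀ (S : Subset n) i {j} → lookup (remove S i) j ≡ true → i ≢ j
remove-excludes S i j∈S-i refl with trans (sym (lookup-remove-self S i)) j∈S-i
... | ()

distinctIn : Subset n → Vec (Fin n) m → Bool
distinctIn S []ᵥ      = true
distinctIn S (i ∷ᵥ σ) = lookup S i ∧ distinctIn (remove S i) σ

distinctIn-∷ : ∀ (S : Subset n) {i} {σ : Vec (Fin n) m} →
  lookup S i ≡ true → distinctIn (remove S i) σ ≡ true → distinctIn S (i ∷ᵥ σ) ≡ true
distinctIn-∷ S {i} {σ} i∈S distinct = trans (cong (_∧ distinctIn (remove S i) σ) i∈S) distinct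

distinctIn-sound : ∀ (S : Subset n) (σ : Vec (Fin n) m) → distinctIn S σ ≡ true →
  Unique (toList σ) × All (λ i → lookup S i ≡ true) (toList σ)
distinctIn-sound S []ᵥ      _ = [] , []
distinctIn-sound S (i ∷ᵥ σ) e with lookup S i in i∈S
... | true with distinctIn-sound (remove S i) σ e
...   | unique , inS-i = All.map (remove-excludes S i) inS-i ∷ unique , i∈S ∷ All.map (lookup-remove-true S i _) inS-i

distinctIn-complete : ∀ (S : Subset n) (σ : Vec (Fin n) m) →
  Unique (toList σ) → All (λ i → lookup S i ≡ true) (toList σ) → distinctIn S σ ≡ true
distinctIn-complete S []ᵥ      _                  _            = refl
distinctIn-complete S (i ∷ᵥ σ) (i∉σ ∷ unique) (i∈S ∷ inS) rewrite i∈S =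
  distinctIn-complete (remove S i) σ unique
    (All.zipWith (λ (j∈S , i≢j) → trans (lookup-remove-≢ S i≢j) j∈S) (inS , i∉σ))

unique?≡distinctIn-⊤ : ∀ (σ : Vec (Fin n) m) → does (unique? _≟F_ (toList σ)) ≡ distinctIn ⊤ σ
unique?≡distinctIn-⊤ σ with unique? _≟F_ (toList σ)
... | yes unique = sym (distinctIn-complete ⊤ σ unique (All.tabulate (λ {i} _ → lookup-replicate i true)))
... | no ¬unique with distinctIn ⊤ σ in e
...   | true  = ⊥-elim (¬unique (proj₁ (distinctIn-sound ⊤ σ e)))
...   | false = refl

remove-mono : ∀ (T S : Subset n) i → (∀ {j} → lookup T j ≡ true → lookup S j ≡ true) →
  ∀ {j} → lookup (remove T i) j ≡ true → lookup (remove S i) j ≡ true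
remove-mono T S i T⊆S {j} j∈T-i =
  trans (lookup-remove-≢ S (remove-excludes T i j∈T-i)) (T⊆S (lookup-remove-true T i j j∈T-i))

allVecs-complete : ∀ (σ : Vec (Fin n) m) → σ ∈ allVecs n m
allVecs-complete []ᵥ      = here refl
allVecs-complete (i ∷ᵥ σ) = ∈-concat⁺′ (∈-map⁺ (i ∷ᵥ_) (allVecs-complete σ)) (∈-map⁺ _ (∈-allFin i))

sumℚ-map-[∧]· : ∀ {A : Set} b (f : A → Bool) (g : A → ℚ) xs →
  sumℚ (map (λ a → [ b ∧ f a ]· g a) xs) ≡ [ b ]· sumℚ (map (λ a → [ f a ]· g a) xs)
sumℚ-map-[∧]· true  f g xs = refl
sumℚ-map-[∧]· false f g xs = sumℚ-map-zero xs

module _ (x : Fin n → ℚ) where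
  open Orderings x

  orderProduct : Weight n → ℚ → Vec (Fin n) m → ℚ
  orderProduct φ c []ᵥ = 1ℚ
  orderProduct {m = suc m} φ c (i ∷ᵥ σ) = φ (suc m) (c * x i) i * orderProduct φ (c * x i) σ

  prodℚ-orderProduct : ∀ φ c (σ : Vec (Fin n) m) →
    prodℚ (map (λ k → φ (m ∸ toℕ k) (c * prodℚ (map x (take (suc (toℕ k)) (toList σ)))) (lookup σ k)) (allFin m))
      ≡ orderProduct φ c σ
  prodℚ-orderProduct φ c []ᵥ = refl
  prodℚ-orderProduct {m = suc m} φ c (i ∷ᵥ σ) = begin
    prodℚ (map (g c (i ∷ᵥ σ)) (allFin (suc m)))
      ≡⟨ cong prodℚ (map-allFin-suc m (g c (i ∷ᵥ σ))) ⟩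
    g c (i ∷ᵥ σ) zero * prodℚ (map (g c (i ∷ᵥ σ) ∘ suc) (allFin m))
      ≡⟨ cong₂ _*_ (cong (λ P → φ (suc m) (c * P) i) (*-identityʳ (x i)))
                   (cong prodℚ (map-cong reassociate (allFin m))) ⟩
    φ (suc m) (c * x i) i * prodℚ (map (g (c * x i) σ) (allFin m))
      ≡⟨ cong (φ (suc m) (c * x i) i *_) (prodℚ-orderProduct φ (c * x i) σ) ⟩
    orderProduct φ c (i ∷ᵥ σ) ∎
    where
    g : ∀ {m} → ℚ → Vec (Fin n) m → Fin m → ℚ
    g {m} c σ k = φ (m ∸ toℕ k) (c * prodℚ (map x (take (suc (toℕ k)) (toList σ)))) (lookup σ k)
    reassociate : ∀ k → g c (i ∷ᵥ σ) (suc k) ≡ g (c * x i) σ k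
    reassociate k = cong (λ P → φ (m ∸ toℕ k) P (lookup σ k)) (sym (*-assoc c (x i) _))

  sumℚ-distinct-orderProduct : ∀ φ m c (S : Subset n) →
    sumℚ (map (λ σ → [ distinctIn S σ ]· orderProduct φ c σ) (allVecs n m)) ≡ orderSumFrom φ m c S
  sumℚ-distinct-orderProduct φ zero    c S = +-identityʳ 1ℚ
  sumℚ-distinct-orderProduct φ (suc m) c S = begin
    sumℚ (map F (concatMap (λ i → map (i ∷ᵥ_) (allVecs n m)) (allFin n)))
      ≡⟨ sumℚ-map-concatMap F (λ i → map (i ∷ᵥ_) (allVecs n m)) (allFin n) ⟩
    sumℚ (map (λ i → sumℚ (map F (map (i ∷ᵥ_) (allVecs n m)))) (allFin n))
      ≡⟨ sumℚ-map-allFin n _ ⟩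
    sum (λ i → sumℚ (map F (map (i ∷ᵥ_) (allVecs n m))))
      ≡⟨ sum-cong-≗ startingWith ⟩
    orderSumFrom φ (suc m) c S ∎
    where
    F : Vec (Fin n) (suc m) → ℚ
    F σ = [ distinctIn S σ ]· orderProduct φ c σ
    a : Fin n → ℚ
    a i = φ (suc m) (c * x i) i
    rest : Fin n → Vec (Fin n) m → ℚ
    rest i σ = [ distinctIn (remove S i) σ ]· orderProduct φ (c * x i) σ
    startingWith : ∀ i → sumℚ (map F (map (i ∷ᵥ_) (allVecs n m)))
                       ≡ [ lookup S i ]· (a i * orderSumFrom φ m (c * x i) (remove S i))
    startingWith i = begin
      sumℚ (map F (map (i ∷ᵥ_) (allVecs n m)))
        ≡⟨ cong sumℚ (sym (map-∘ (allVecs n m))) ⟩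
      sumℚ (map (λ σ → [ lookup S i ∧ distinctIn (remove S i) σ ]· (a i * orderProduct φ (c * x i) σ)) (allVecs n m))
        ≡⟨ sumℚ-map-[∧]· (lookup S i) (distinctIn (remove S i)) _ (allVecs n m) ⟩
      [ lookup S i ]· sumℚ (map (λ σ → [ distinctIn (remove S i) σ ]· (a i * orderProduct φ (c * x i) σ)) (allVecs n m))
        ≡⟨ cong ([ lookup S i ]·_)
             (cong sumℚ (map-cong (λ σ → []·-*-comm (distinctIn (remove S i) σ) (a i) _) (allVecs n m))) ⟩
      [ lookup S i ]· sumℚ (map (λ σ → a i * rest i σ) (allVecs n m))
        ≡⟨ cong ([ lookup S i ]·_) (sym (*-distribˡ-sumℚ-map (a i) (rest i) (allVecs n m))) ⟩
      [ lookup S i ]· (a i * sumℚ (map (rest i) (allVecs n m)))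
        ≡⟨ cong (λ r → [ lookup S i ]· (a i * r)) (sumℚ-distinct-orderProduct φ m (c * x i) (remove S i)) ⟩
      [ lookup S i ]· (a i * orderSumFrom φ m (c * x i) (remove S i)) ∎

  sumSn-orderSum : ∀ (φ : Weight n) (f : Vec (Fin n) n → Fin n → ℚ) →
    (∀ σ k → f σ k ≡ φ (n ∸ toℕ k) (prefixProd x σ k) (lookup σ k)) →
    sumSn n (λ σ → prodK n (f σ)) ≡ orderSum φ ⊤
  sumSn-orderSum φ f f≡φ = begin
    sumℚ (map (λ σ → prodK n (f σ)) (filter (λ σ → unique? _≟F_ (toList σ)) (allVecs n n)))
      ≡⟨ sumℚ-map-filter (λ σ → unique? _≟F_ (toList σ)) (λ σ → prodK n (f σ)) (allVecs n n) ⟩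
    sumℚ (map (λ σ → [ does (unique? _≟F_ (toList σ)) ]· prodK n (f σ)) (allVecs n n))
      ≡⟨ cong sumℚ (map-cong (λ σ → cong₂ [_]·_ (unique?≡distinctIn-⊤ σ) (product σ)) (allVecs n n)) ⟩
    sumℚ (map (λ σ → [ distinctIn ⊤ σ ]· orderProduct φ 1ℚ σ) (allVecs n n))
      ≡⟨ sumℚ-distinct-orderProduct φ n 1ℚ ⊤ ⟩
    orderSumFrom φ n 1ℚ ⊤
      ≡⟨ cong (λ m → orderSumFrom φ m 1ℚ ⊤) (sym (∣⊤∣≡n n)) ⟩
    orderSum φ ⊤ ∎
    where
    product : ∀ σ → prodK n (f σ) ≡ orderProduct φ 1ℚ σ
    product σ = trans (cong prodℚ (map-cong (λ k → trans (f≡φ σ k) (unit k)) (allFin n)))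
                      (prodℚ-orderProduct φ 1ℚ σ)
      where
      unit : ∀ k → φ (n ∸ toℕ k) (prefixProd x σ k) (lookup σ k) ≡ φ (n ∸ toℕ k) (1ℚ * prefixProd x σ k) (lookup σ k)
      unit k = cong (λ P → φ (n ∸ toℕ k) P (lookup σ k)) (sym (*-identityˡ _))

  ordering-with-prefix : ∀ m (T S : Subset n) → (∀ {i} → lookup T i ≡ true → lookup S i ≡ true) → ∣ S ∣ ≡ m →
    Σ (Vec (Fin n) m) λ σ → distinctIn S σ ≡ true × prodℚ (map x (take ∣ T ∣ (toList σ))) ≡ monomial x T
  ordering-with-prefix zero T S T⊆S ∣S∣≡0 with ∣ T ∣ in ∣T∣≡
  ... | zero  = []ᵥ , refl , sym (monomial-empty x T ∣T∣≡)
  ... | suc _ with nonempty-member T ∣T∣≡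
  ...   | i , i∈T = ⊥-elim (lookup-empty S i ∣S∣≡0 (T⊆S i∈T))
  ordering-with-prefix (suc m) T S T⊆S ∣S∣≡1+m with ∣ T ∣ in ∣T∣≡
  ... | zero with nonempty-member S ∣S∣≡1+m
  ...   | i , i∈S with ordering-with-prefix m T (remove S i) (λ {j} j∈T → ⊥-elim (lookup-empty T j ∣T∣≡ j∈T))
                                                               (∣remove∣ S i ∣S∣≡1+m i∈S)
  ...     | σ , distinct , _ = i ∷ᵥ σ , distinctIn-∷ S {σ = σ} i∈S distinct , sym (monomial-empty x T ∣T∣≡)
  ordering-with-prefix (suc m) T S T⊆S ∣S∣≡1+m | suc k with nonempty-member T ∣T∣≡
  ...   | i , i∈T with ordering-with-prefix m (remove T i) (remove S i) (remove-mono T S i T⊆S)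
                                                                        (∣remove∣ S i ∣S∣≡1+m (T⊆S i∈T))
  ...     | σ , distinct , prefix = i ∷ᵥ σ , distinctIn-∷ S {σ = σ} (T⊆S i∈T) distinct , (begin
    x i * prodℚ (map x (take k (toList σ)))
      ≡⟨ cong (λ l → x i * prodℚ (map x (take l (toList σ)))) (sym (∣remove∣ T i ∣T∣≡ i∈T)) ⟩
    x i * prodℚ (map x (take ∣ remove T i ∣ (toList σ)))
      ≡⟨ cong (x i *_) prefix ⟩
    x i * monomial x (remove T i)
      ≡⟨ sym (monomial-remove x T i i∈T) ⟩
    monomial x T ∎)

  nonvanishingDenominators : DenomsNonzero n x → NonvanishingDenominators
  nonvanishingDenominators denoms S {k} ∣S∣≡1+k
    with ordering-with-prefix n S ⊤ (λ {i} _ → lookup-replicate i true) (∣⊤∣≡n n)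
  ... | σ , distinct , prefix = λ 1-X≡0 → denoms σ σ∈Sn k′ (trans (cong (λ P → 1ℚ - P) prefix≡) 1-X≡0)
    where
    k<n : k < n
    k<n = subst (_≤ n) ∣S∣≡1+k (∣p∣≤n S)
    k′ = fromℕ< k<n
    prefix≡ : prefixProd x σ k′ ≡ monomial x S
    prefix≡ = trans (cong (λ l → prodℚ (map x (take l (toList σ))))
                          (trans (cong suc (toℕ-fromℕ< k<n)) (sym ∣S∣≡1+k)))
                    prefix
    σ∈Sn : σ ∈ Perms n
    σ∈Sn = ∈-filter⁺ (λ σ → unique? _≟F_ (toList σ)) (allVecs-complete σ)
                     (proj₁ (distinctIn-sound ⊤ σ distinct))

mainTheorem11 : (n : ℕ) (x y : Fin n → ℚ) → DenomsNonzero n x → LHS n x y ≡ RHS n x y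
mainTheorem11 n x y denoms = begin
  LHS n x y                     ≡⟨ sumSn-orderSum x lhsWeight _ (λ σ k → refl) ⟩
  orderSum lhsWeight ⊤          ≡⟨ lhs≡rhs ⊤ ⟩
  orderSum (rhsWeight 0) ⊤      ≡⟨ sym (sumSn-orderSum x (rhsWeight 0) _ (λ σ k → refl)) ⟩
  RHS n x y                     ∎
  where
  open Orderings x using (orderSum)
  open Families x y (nonvanishingDenominators x denoms)
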